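{- Let $p(t)=\sum_{s=0}^r c_s(t)t^s$ be a quasi-polynomial of degree $r>0$ and let $k\in\mathbb{N}$ with $c_r(k)>0$. Then there exist $n\in\mathbb{N}_{>0}$ and $N\in\mathbb{N}$ such that for all $i\in k+n\cdot\mathbb{N}$ with $i\ge N$, $2p(i)<p(i+ni)$.
   Context: A quasi-polynomial of degree $r$ is a function $p:\mathbb{N}\to\mathbb{Z}$ of the form $p(t)=c_r(t)t^r+\dots+c_0(t)$ where $c_0,\dots,c_r:\mathbb{N}\to\mathbb{Z}$ are periodic functions with integral periods and $c_r$ is not identically zero. $\mathbb{N}=\{0,1,2,\dots\}$. -}

module Defs where

open import Data.Nat as ℕ using (ℕ; zero; suc)
open import Data.Fin using (Fin; toℕ; fromℕ)
open import Data.Integer as ℤ using (ℤ; +_)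
open import Data.Product using (Σ; ∃; _×_)
open import Relation.Binary.PropositionalEquality using (_≡_)
open import Relation.Nullary using (¬_)

Periodic : (ℕ → ℤ) → Set
Periodic f = Σ ℕ λ d → (0 ℕ.< d) × (∀ t → f (t ℕ.+ d) ≡ f t)

∑ : ∀ {n} → (Fin n → ℤ) → ℤ
∑ {zero}  f = + 0
∑ {suc n} f = f Fin.zero ℤ.+ ∑ (λ i → f (Fin.suc i))

record QuasiPoly (r : ℕ) : Set where
  field
    coeff    : Fin (suc r) → ℕ → ℤ
    periodic : ∀ s → Periodic (coeff s)
    leading≢0 : ¬ (∀ t → coeff (fromℕ r) t ≡ + 0)

eval : ∀ {r} → QuasiPoly r → ℕ → ℤ
eval {r} p t = ∑ (λ s → QuasiPoly.coeff p s t ℤ.* (+ t) ℤ.^ toℕ s)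

lead : ∀ {r} → QuasiPoly r → ℕ → ℤ
lead {r} p = QuasiPoly.coeff p (fromℕ r)

module Submission where

-- Let D > 0 be a common period of the coefficient
-- functions c_0,…,c_r and put n = 2D.  Then n is a period of every c_s, so
-- on the residue class k + n·ℕ each c_s is the constant a_s = c_s(k).  Both
-- i = k + n·m and i + n·i = (1 + n)·i lie in this class, hence
--   p((1+n)·i) = 2·p(i) + Σ_s a_s·((1+n)^s − 2)·i^s .
-- The polynomial on the right has leading coefficient a_r·((1+n)^r − 2),
-- positive because 1 + n ≥ 3 and r > 0, so it is positive at every i
-- exceeding the sum of the absolute values of its lower coefficients.

open import Defs
open import Data.Nat as ℕ using (ℕ; zero; suc; _+_; _*_; _<_; _≥_; z≤n; s≤s)
import Data.Nat.Properties as ℕP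
open import Data.Integer as ℤ using (ℤ; +_; -[1+_]; +[1+_]; ∣_∣; +<+; +≤+; -<+)
import Data.Integer.Properties as ℤP
open import Data.Fin using (Fin; toℕ; fromℕ; inject₁)
import Data.Fin.Properties as FP
open import Data.Product using (Σ; _×_; _,_)
open import Relation.Binary.PropositionalEquality
import Data.Integer.Tactic.RingSolver as ℤ-Ring
import Data.Nat.Tactic.RingSolver as ℕ-Ring

∑-cong : ∀ {n} {f g : Fin n → ℤ} → (∀ s → f s ≡ g s) → ∑ f ≡ ∑ g
∑-cong {zero}  f≡g = refl
∑-cong {suc n} f≡g = cong₂ ℤ._+_ (f≡g Fin.zero) (∑-cong (λ s → f≡g (Fin.suc s)))

∑-+ : ∀ {n} (f g : Fin n → ℤ) → ∑ (λ s → f s ℤ.+ g s) ≡ ∑ f ℤ.+ ∑ g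
∑-+ {zero}  f g = refl
∑-+ {suc n} f g = begin
  (f₀ ℤ.+ g₀) ℤ.+ ∑ (λ s → f (Fin.suc s) ℤ.+ g (Fin.suc s))
    ≡⟨ cong (λ z → (f₀ ℤ.+ g₀) ℤ.+ z) (∑-+ (λ s → f (Fin.suc s)) (λ s → g (Fin.suc s))) ⟩
  (f₀ ℤ.+ g₀) ℤ.+ (∑ (λ s → f (Fin.suc s)) ℤ.+ ∑ (λ s → g (Fin.suc s)))
    ≡⟨ interchange f₀ g₀ _ _ ⟩
  (f₀ ℤ.+ ∑ (λ s → f (Fin.suc s))) ℤ.+ (g₀ ℤ.+ ∑ (λ s → g (Fin.suc s))) ∎
  where
  open ≡-Reasoning
  f₀ g₀ : ℤ
  f₀ = f Fin.zero
  g₀ = g Fin.zero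
  interchange : ∀ (a b c d : ℤ) → (a ℤ.+ b) ℤ.+ (c ℤ.+ d) ≡ (a ℤ.+ c) ℤ.+ (b ℤ.+ d)
  interchange = ℤ-Ring.solve-∀

∑-*ˡ : ∀ {n} (c : ℤ) (f : Fin n → ℤ) → ∑ (λ s → c ℤ.* f s) ≡ c ℤ.* ∑ f
∑-*ˡ {zero}  c f = sym (ℤP.*-zeroʳ c)
∑-*ˡ {suc n} c f = trans (cong (λ z → c ℤ.* f Fin.zero ℤ.+ z) (∑-*ˡ c (λ s → f (Fin.suc s))))
                         (sym (ℤP.*-distribˡ-+ c _ _))

∑-*ʳ : ∀ {n} (c : ℤ) (f : Fin n → ℤ) → ∑ (λ s → f s ℤ.* c) ≡ ∑ f ℤ.* c
∑-*ʳ c f = trans (∑-cong (λ s → ℤP.*-comm (f s) c)) (trans (∑-*ˡ c f) (ℤP.*-comm c _))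

∑-nonneg : ∀ {n} {f : Fin n → ℤ} → (∀ s → + 0 ℤ.≤ f s) → + 0 ℤ.≤ ∑ f
∑-nonneg {zero}  f≥0 = ℤP.≤-refl
∑-nonneg {suc n} f≥0 = ℤP.+-mono-≤ (f≥0 Fin.zero) (∑-nonneg (λ s → f≥0 (Fin.suc s)))

∑-last : ∀ {n} (f : Fin (suc n) → ℤ) → ∑ f ≡ ∑ (λ s → f (inject₁ s)) ℤ.+ f (fromℕ n)
∑-last {zero}  f = ℤP.+-comm (f Fin.zero) (+ 0)
∑-last {suc n} f = trans (cong (λ z → f Fin.zero ℤ.+ z) (∑-last (λ s → f (Fin.suc s))))
                         (sym (ℤP.+-assoc (f Fin.zero) _ _))

pos-^ : ∀ x e → (+ x) ℤ.^ e ≡ + (x ℕ.^ e)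
pos-^ x zero    = refl
pos-^ x (suc e) = trans (cong (+ x ℤ.*_) (pos-^ x e)) (sym (ℤP.pos-* x (x ℕ.^ e)))

^-distribʳ-* : ∀ (x y : ℤ) e → (x ℤ.* y) ℤ.^ e ≡ x ℤ.^ e ℤ.* y ℤ.^ e
^-distribʳ-* x y zero    = refl
^-distribʳ-* x y (suc e) = trans (cong (x ℤ.* y ℤ.*_) (^-distribʳ-* x y e))
                                 (interchange x y (x ℤ.^ e) (y ℤ.^ e))
  where
  interchange : ∀ (a b c d : ℤ) → (a ℤ.* b) ℤ.* (c ℤ.* d) ≡ (a ℤ.* c) ℤ.* (b ℤ.* d)
  interchange = ℤ-Ring.solve-∀

-- A quasi-polynomial evaluated at t is the polynomial with the
-- coefficients frozen at t:  eval p t = polyAt (λ s → c_s(t)) (+ t).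

polyAt : ∀ {n} → (Fin n → ℤ) → ℤ → ℤ
polyAt b x = ∑ (λ s → b s ℤ.* x ℤ.^ toℕ s)

dilation : ∀ {n} (a : Fin n → ℤ) (c x : ℤ) →
  polyAt a (c ℤ.* x) ≡ + 2 ℤ.* polyAt a x ℤ.+ polyAt (λ s → a s ℤ.* (c ℤ.^ toℕ s ℤ.- + 2)) x
dilation a c x = begin
  ∑ (λ s → a s ℤ.* (c ℤ.* x) ℤ.^ toℕ s)
    ≡⟨ ∑-cong termwise ⟩
  ∑ (λ s → + 2 ℤ.* (a s ℤ.* x ℤ.^ toℕ s) ℤ.+ b s ℤ.* x ℤ.^ toℕ s)
    ≡⟨ ∑-+ (λ s → + 2 ℤ.* (a s ℤ.* x ℤ.^ toℕ s)) (λ s → b s ℤ.* x ℤ.^ toℕ s) ⟩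
  ∑ (λ s → + 2 ℤ.* (a s ℤ.* x ℤ.^ toℕ s)) ℤ.+ polyAt b x
    ≡⟨ cong (ℤ._+ polyAt b x) (∑-*ˡ (+ 2) (λ s → a s ℤ.* x ℤ.^ toℕ s)) ⟩
  + 2 ℤ.* polyAt a x ℤ.+ polyAt b x ∎
  where
  open ≡-Reasoning
  b : Fin _ → ℤ
  b s = a s ℤ.* (c ℤ.^ toℕ s ℤ.- + 2)
  split : ∀ (α C X : ℤ) → α ℤ.* (C ℤ.* X) ≡ + 2 ℤ.* (α ℤ.* X) ℤ.+ α ℤ.* (C ℤ.- + 2) ℤ.* X
  split = ℤ-Ring.solve-∀
  termwise : ∀ s → a s ℤ.* (c ℤ.* x) ℤ.^ toℕ s ≡ + 2 ℤ.* (a s ℤ.* x ℤ.^ toℕ s) ℤ.+ b s ℤ.* x ℤ.^ toℕ s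
  termwise s = trans (cong (a s ℤ.*_) (^-distribʳ-* c x (toℕ s))) (split (a s) (c ℤ.^ toℕ s) (x ℤ.^ toℕ s))

absorb-term : ∀ b {u v} → u ℕ.≤ v → + 0 ℤ.≤ + ∣ b ∣ ℤ.* + v ℤ.+ b ℤ.* + u
absorb-term (+ n) {u} {v} _ rewrite sym (ℤP.pos-* n v) | sym (ℤP.pos-* n u) = +≤+ z≤n
absorb-term -[1+ n ] {u} {v} u≤v rewrite sym (ℤP.neg-distribˡ-* +[1+ n ] (+ u)) =
  ℤP.i≤j⇒0≤j-i (ℤP.*-monoˡ-≤-nonNeg +[1+ n ] (+≤+ u≤v))

below-beyond-abs : ∀ z {x} → suc ∣ z ∣ ℕ.≤ x → z ℤ.< + x
below-beyond-abs (+ n)    |z|<x = +<+ |z|<x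
below-beyond-abs -[1+ n ] _     = -<+

lowWeight : ∀ {r} → (Fin (suc (suc r)) → ℤ) → ℤ
lowWeight b = ∑ (λ s → + ∣ b (inject₁ s) ∣)

-- A polynomial of positive degree with positive leading coefficient is
-- positive at every natural number exceeding the weight of its lower
-- coefficients: with W the weight and x^r = Y, the lower part is at least
-- −W·Y while the leading term is at least x·Y > W·Y.

positive-beyond-weight : ∀ r (b : Fin (suc (suc r)) → ℤ) → + 0 ℤ.< b (fromℕ (suc r)) →
  ∀ x → lowWeight b ℤ.< + x → + 0 ℤ.< polyAt b (+ x)
positive-beyond-weight r b lead>0 x W<x =
  subst (+ 0 ℤ.<_) (sym (∑-last (λ s → b s ℤ.* (+ x) ℤ.^ toℕ s)))
    (ℤP.≤-<-trans lower≥−WY (subst (W ℤ.* + Y ℤ.+ low ℤ.<_) (ℤP.+-comm top low)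
                                     (ℤP.+-monoˡ-< low WY<top)))
  where
  W : ℤ
  W = lowWeight b
  Y : ℕ
  Y = x ℕ.^ r
  low top : ℤ
  low = ∑ (λ s → b (inject₁ s) ℤ.* (+ x) ℤ.^ toℕ (inject₁ s))
  top = b (fromℕ (suc r)) ℤ.* (+ x) ℤ.^ toℕ (fromℕ (suc r))

  x>0 : 0 < x
  x>0 with ℤP.≤-<-trans (∑-nonneg {f = λ s → + ∣ b (inject₁ s) ∣} (λ _ → +≤+ z≤n)) W<x
  ... | +<+ 0<x = 0<x
  instance
    x≢0 : ℕ.NonZero x
    x≢0 = ℕ.>-nonZero x>0
    +Y>0 : ℤ.Positive (+ Y)
    +Y>0 = ℤ.positive (+<+ (ℕP.m^n>0 x r))

  lowTerm : ∀ s → + 0 ℤ.≤ + ∣ b (inject₁ s) ∣ ℤ.* + Y ℤ.+ b (inject₁ s) ℤ.* (+ x) ℤ.^ toℕ (inject₁ s)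
  lowTerm s rewrite pos-^ x (toℕ (inject₁ s)) =
    absorb-term (b (inject₁ s)) (ℕP.^-monoʳ-≤ x (subst (ℕ._≤ r) (sym (FP.toℕ-inject₁ s)) (FP.toℕ≤pred[n] s)))

  lower≥−WY : + 0 ℤ.≤ W ℤ.* + Y ℤ.+ low
  lower≥−WY = subst (+ 0 ℤ.≤_)
    (trans (∑-+ (λ s → + ∣ b (inject₁ s) ∣ ℤ.* + Y) (λ s → b (inject₁ s) ℤ.* (+ x) ℤ.^ toℕ (inject₁ s)))
           (cong (ℤ._+ low) (∑-*ʳ (+ Y) (λ s → + ∣ b (inject₁ s) ∣))))
    (∑-nonneg lowTerm)

  WY<top : W ℤ.* + Y ℤ.< top
  WY<top = begin-strict
    W ℤ.* + Y                          <⟨ ℤP.*-monoʳ-<-pos (+ Y) W<x ⟩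
    + x ℤ.* + Y                        ≡⟨ ℤP.pos-* x Y ⟨
    + (x * Y)                          ≡⟨ ℤP.*-identityˡ (+ (x * Y)) ⟨
    + 1 ℤ.* + (x * Y)                  ≤⟨ ℤP.*-monoʳ-≤-nonNeg (+ (x * Y)) (ℤP.i<j⇒suc[i]≤j lead>0) ⟩
    b (fromℕ (suc r)) ℤ.* + (x * Y)    ≡⟨ cong (b (fromℕ (suc r)) ℤ.*_) leadingPower ⟨
    top                                ∎
    where
    open ℤP.≤-Reasoning
    leadingPower : (+ x) ℤ.^ toℕ (fromℕ (suc r)) ≡ + (x * Y)
    leadingPower = trans (cong ((+ x) ℤ.^_) (FP.toℕ-fromℕ (suc r))) (pos-^ x (suc r))

IsPeriod : (ℕ → ℤ) → ℕ → Set
IsPeriod f d = ∀ t → f (t + d) ≡ f t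

period-multiple : ∀ {f d} → IsPeriod f d → ∀ j → IsPeriod f (d * j)
period-multiple {f} {d} per zero    t = cong f (trans (cong (λ z → t + z) (ℕP.*-zeroʳ d)) (ℕP.+-identityʳ t))
period-multiple {f} {d} per (suc j) t = begin
  f (t + d * suc j)   ≡⟨ cong f (regroup t d j) ⟩
  f (t + d * j + d)   ≡⟨ per (t + d * j) ⟩
  f (t + d * j)       ≡⟨ period-multiple per j t ⟩
  f t                 ∎
  where
  open ≡-Reasoning
  regroup : ∀ t d j → t + d * suc j ≡ t + d * j + d
  regroup = ℕ-Ring.solve-∀

-- Finitely many periodic functions have a common positive period (the
-- product of their periods).

commonPeriod : ∀ {n} (f : Fin n → ℕ → ℤ) → (∀ s → Periodic (f s)) →
  Σ ℕ λ D → 0 < D × (∀ s → IsPeriod (f s) D)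
commonPeriod {zero}  f periodic = 1 , s≤s z≤n , λ ()
commonPeriod {suc n} f periodic with periodic Fin.zero | commonPeriod (λ s → f (Fin.suc s)) (λ s → periodic (Fin.suc s))
... | d , d>0 , per₀ | D , D>0 , perₛ = d * D , ℕP.m<n⇒m<n*o D d>0 , isPeriod
  where
  instance
    D≢0 : ℕ.NonZero D
    D≢0 = ℕ.>-nonZero D>0
  isPeriod : ∀ s → IsPeriod (f s) (d * D)
  isPeriod Fin.zero    = period-multiple per₀ D
  isPeriod (Fin.suc s) = subst (IsPeriod (f (Fin.suc s))) (ℕP.*-comm D d) (period-multiple (perₛ s) d)

eval-on-residue-class : ∀ {r n} (p : QuasiPoly r) → (∀ s → IsPeriod (QuasiPoly.coeff p s) n) →
  ∀ k j {t} → t ≡ k + n * j → eval p t ≡ polyAt (λ s → QuasiPoly.coeff p s k) (+ t)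
eval-on-residue-class p per k j {t} t≡k+nj =
  ∑-cong (λ s → cong (ℤ._* (+ t) ℤ.^ toℕ s) (trans (cong (coeff s) t≡k+nj) (period-multiple (per s) j k)))
  where open QuasiPoly p

dilation-factor-pos : ∀ c e → 2 < c → 0 < e → + 0 ℤ.< (+ c) ℤ.^ e ℤ.- + 2
dilation-factor-pos c (suc e) c>2 _ rewrite pos-^ c (suc e) =
  ℤP.+-monoˡ-< (ℤ.- + 2) (+<+ (ℕP.<-≤-trans c>2 (ℕP.m≤m*n c (c ℕ.^ e))))
  where
  instance
    c^e≢0 : ℕ.NonZero (c ℕ.^ e)
    c^e≢0 = ℕP.m^n≢0 c e {{ℕ.>-nonZero (ℕP.<-trans (s≤s z≤n) c>2)}}

-- The coefficients a_s·(c^s − 2) of p(c·x) − 2·p(x) on the residue class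
-- of k, where a_s = c_s(k).

dilatedCoeffs : ∀ {r} → QuasiPoly r → ℕ → ℕ → Fin (suc r) → ℤ
dilatedCoeffs p k c s = QuasiPoly.coeff p s k ℤ.* ((+ c) ℤ.^ toℕ s ℤ.- + 2)

doubling-on-class : ∀ r n (p : QuasiPoly (suc r)) k → 2 ℕ.≤ n →
  (∀ s → IsPeriod (QuasiPoly.coeff p s) n) → + 0 ℤ.< lead p k →
  ∀ m → let i = k + n * m in suc ∣ lowWeight (dilatedCoeffs p k (suc n)) ∣ ℕ.≤ i →
  + 2 ℤ.* eval p i ℤ.< eval p (i + n * i)
doubling-on-class r n p k n≥2 per lead>0 m i≥N = begin-strict
  + 2 ℤ.* eval p i                          ≡⟨ cong (+ 2 ℤ.*_) (on-class m refl) ⟩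
  + 2 ℤ.* polyAt a (+ i)                    ≡⟨ ℤP.+-identityʳ _ ⟨
  + 2 ℤ.* polyAt a (+ i) ℤ.+ + 0            <⟨ ℤP.+-monoʳ-< (+ 2 ℤ.* polyAt a (+ i)) b-positive ⟩
  + 2 ℤ.* polyAt a (+ i) ℤ.+ polyAt b (+ i) ≡⟨ dilation a (+ c) (+ i) ⟨
  polyAt a (+ c ℤ.* + i)                    ≡⟨ cong (polyAt a) (ℤP.pos-* c i) ⟨
  polyAt a (+ (i + n * i))                  ≡⟨ on-class (m + i) i+ni-in-class ⟨
  eval p (i + n * i)                        ∎
  where
  open ℤP.≤-Reasoning
  i c : ℕ
  i = k + n * m
  c = suc n
  a b : Fin (suc (suc r)) → ℤ
  a s = QuasiPoly.coeff p s k
  b = dilatedCoeffs p k c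

  on-class : ∀ j {t} → t ≡ k + n * j → eval p t ≡ polyAt a (+ t)
  on-class = eval-on-residue-class p per k

  i+ni-in-class : i + n * i ≡ k + n * (m + i)
  i+ni-in-class = trans (ℕP.+-assoc k (n * m) (n * i)) (cong (λ z → k + z) (sym (ℕP.*-distribˡ-+ n m i)))

  -- The leading coefficient a_{r+1}·(c^{r+1} − 2) is positive since c ≥ 3.
  b-lead>0 : + 0 ℤ.< b (fromℕ (suc r))
  b-lead>0 = subst (ℤ._< b (fromℕ (suc r))) (ℤP.*-zeroʳ (a (fromℕ (suc r))))
    (ℤP.*-monoˡ-<-pos (a (fromℕ (suc r))) {{ℤ.positive lead>0}}
      (dilation-factor-pos c (toℕ (fromℕ (suc r))) (s≤s n≥2)
                           (subst (0 <_) (sym (FP.toℕ-fromℕ (suc r))) (s≤s z≤n))))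

  b-positive : + 0 ℤ.< polyAt b (+ i)
  b-positive = positive-beyond-weight r b b-lead>0 i (below-beyond-abs (lowWeight b) i≥N)

-- Main theorem: take n = 2D for a common period D of the coefficients.

lemma3p16 : (r : ℕ) → 0 < r → (p : QuasiPoly r) → (k : ℕ) → + 0 ℤ.< lead p k →
    Σ ℕ λ n → 0 < n × Σ ℕ λ N →
    (m : ℕ) → let i = k + n * m in i ≥ N →
    + 2 ℤ.* eval p i ℤ.< eval p (i + n * i)
lemma3p16 (suc r) _ p k lead>0 with commonPeriod (QuasiPoly.coeff p) (QuasiPoly.periodic p)
... | D , D>0 , per =
  n , ℕP.m<n⇒m<n*o 2 D>0 , suc ∣ lowWeight (dilatedCoeffs p k (suc n)) ∣ ,
  doubling-on-class r n p k (ℕP.*-monoˡ-≤ 2 D>0) (λ s → period-multiple (per s) 2) lead>0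
  where
  n : ℕ
  n = D * 2
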